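{- Let $n\ge 2$ (with $C_2$ taken to be $K_2$) and $p\ge0$ be integers. The independence number of the $p$-augmented 2-token graph $F_2^p(C_n)$ is, writing $n=4r+s$ with $s\in\{0,1,2,3\}$: - if $n=4r$: $\alpha=(r+\tfrac p2)n$ for all $p$; - if $n=4r+1$: $\alpha=(r+\tfrac p2)n$ for even $p$, and $\alpha=(r+\tfrac p2)n-\tfrac12$ for odd $p$; - if $n=4r+2$: $\alpha=(r+\tfrac p2+\tfrac12)n$ for all $p$; - if $n=4r+3$: $\alpha=(r+\tfrac p2+\tfrac12)n-\tfrac12$ for even $p$, and $\alpha=(r+\tfrac p2+\tfrac12)n$ for odd $p$.
   Context: All indices are in $\mathbb Z_n$. The 2-token graph $F_2(C_n)$ has as vertices the 2-element subsets of $\mathbb Z_n$, with $\{a,b\}\sim\{a,c\}$ iff $bc$ is an edge of $C_n$ (and $c\neq a$). The $p$-augmented 2-token graph $F_2^p(C_n)$ is obtained from $F_2(C_n)$ (layer $0$, where the vertex $\{i,i+1\}$ is denoted $\{i,i+1\}^0$) by adding, for each $\ell=1,\ldots,p$, a layer of $n$ new vertices: if $\ell$ is odd, vertices $\{i,i\}^\ell$ ($i\in\mathbb Z_n$); if $\ell$ is even, vertices $\{i,i+1\}^\ell$ ($i\in\mathbb Z_n$, distinct for distinct $i$). New edges: for odd $\ell$, $\{i,i\}^\ell$ is adjacent to $\{i,i+1\}^{\ell-1}$ and $\{i-1,i\}^{\ell-1}$; for even $\ell\ge2$, $\{i,i+1\}^\ell$ is adjacent to $\{i,i\}^{\ell-1}$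 and $\{i+1,i+1\}^{\ell-1}$. Thus $F_2^p(C_n)$ has $\binom n2+pn$ vertices, $F_2^0(C_n)=F_2(C_n)$, and $F_2^1(C_n)$ is the 2-supertoken graph of $C_n$ (vertices: multisets of size 2 of $\mathbb Z_n$, adjacent iff one is obtained from the other by moving one element along an edge of $C_n$). $\alpha$ is the independence number. -}

module Defs where

open import Data.Nat using (ℕ; zero; suc; _+_; _*_; _≤_; _%_)
open import Data.Fin using (Fin; toℕ) renaming (_<_ to _<ᶠ_)
open import Data.List using (List; length)
open import Data.List.Membership.Propositional using (_∈_)
open import Data.List.Relation.Unary.Unique.Propositional using (Unique)
open import Data.Product using (Σ; _×_; ∃-syntax)
open import Data.Sum using (_⊎_)
open import Relation.Nullary using (¬_)
open import Relation.Binary.PropositionalEquality using (_≡_)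

Next : ℕ → ℕ → ℕ → Set
Next n x y = (suc x ≡ y) ⊎ ((suc x ≡ n) × (y ≡ 0))

-- Edge bc of C_n (for n = 2 this is K_2).
CycAdj : (n : ℕ) → Fin n → Fin n → Set
CycAdj n b c = Next n (toℕ b) (toℕ c) ⊎ Next n (toℕ c) (toℕ b)

Rep : ∀ {n} → Fin n → Fin n → Fin n → Fin n → Set
Rep x y a b = ((x ≡ a) × (y ≡ b)) ⊎ ((x ≡ b) × (y ≡ a))

-- Vertices of F_2^p(C_n):
--  base a b _ : the 2-subset {a,b} (a < b) of layer 0;
--  layer k i  : the vertex of layer ℓ = toℕ k + 1 indexed by i, i.e.
--               {i,i}^ℓ if ℓ is odd and {i,i+1}^ℓ if ℓ is even.
data Vtx (n p : ℕ) : Set where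
  base  : (a b : Fin n) → a <ᶠ b → Vtx n p
  layer : Fin p → Fin n → Vtx n p

data Down {n p : ℕ} : Vtx n p → Vtx n p → Set where
  -- ℓ = 1: {i,i}^1 ~ {i,i+1}^0 and {i-1,i}^0
  d1a : ∀ {k i j x y x<y} → toℕ k ≡ 0 → Next n (toℕ i) (toℕ j) → Rep x y i j →
        Down (layer k i) (base x y x<y)
  d1b : ∀ {k i j x y x<y} → toℕ k ≡ 0 → Next n (toℕ j) (toℕ i) → Rep x y j i →
        Down (layer k i) (base x y x<y)
  -- odd ℓ ≥ 3: {i,i}^ℓ ~ {i,i+1}^(ℓ-1) and {i-1,i}^(ℓ-1)
  dOddA : ∀ {k k' i} → toℕ k ≡ suc (toℕ k') → toℕ k % 2 ≡ 0 →
          Down (layer k i) (layer k' i)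
  dOddB : ∀ {k k' i j} → toℕ k ≡ suc (toℕ k') → toℕ k % 2 ≡ 0 →
          Next n (toℕ j) (toℕ i) → Down (layer k i) (layer k' j)
  -- even ℓ ≥ 2: {i,i+1}^ℓ ~ {i,i}^(ℓ-1) and {i+1,i+1}^(ℓ-1)
  dEvenA : ∀ {k k' i} → toℕ k ≡ suc (toℕ k') → toℕ k % 2 ≡ 1 →
           Down (layer k i) (layer k' i)
  dEvenB : ∀ {k k' i j} → toℕ k ≡ suc (toℕ k') → toℕ k % 2 ≡ 1 →
           Next n (toℕ i) (toℕ j) → Down (layer k i) (layer k' j)

data Adj {n p : ℕ} : Vtx n p → Vtx n p → Set where
  tok  : ∀ {x y x<y x' y' x'<y'} (a b c : Fin n) →
         Rep x y a b → Rep x' y' a c → CycAdj n b c →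
         Adj (base x y x<y) (base x' y' x'<y')
  down : ∀ {u v} → Down u v → Adj u v
  up   : ∀ {u v} → Down v u → Adj u v

Independent : ∀ {n p} → List (Vtx n p) → Set
Independent {n} {p} S = Unique S × (∀ {u v} → u ∈ S → v ∈ S → ¬ Adj {n} {p} u v)

IsIndependenceNumber : ℕ → ℕ → ℕ → Set
IsIndependenceNumber n p k =
  (Σ (List (Vtx n p)) λ S → Independent S × length S ≡ k) ×
  (∀ (S : List (Vtx n p)) → Independent S → length S ≤ k)

module Submission where

-- Let m = ⌊n/2⌋ and place the vertices of F₂ᵖ(Cₙ) on a grid of levels 0, …, m+p−1
-- and positions in ℤₙ: a 2-set {a, a+d} whose shorter arc runs forward from a over d steps sits
-- at level m−d and position a, and the vertex of layer ℓ indexed by i sits at level m+ℓ−1 and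
-- position i. Every level has n vertices, except level 0, which has n/2 pairwise non-adjacent
-- vertices for n even and is an odd n-cycle for n odd. Edges only join consecutive levels (or two
-- vertices of level 0), and two vertices with the same position on consecutive levels are always
-- adjacent. So an independent set has at most one vertex per position in each pair of consecutive
-- levels. Pairing the levels from 0 when m+p = 2q, and from 1 when m+p = 2q+1 (level 0 then
-- contributing at most m), bounds α by q·n, resp. q·n + m; taking every other level completely
-- (plus m vertices of level 0 when m+p is odd) attains the bound.

open import Defs
open import Data.Nat
open import Data.Nat.Properties
open import Data.Nat.DivMod using (m%n<n; m≡m%n+[m/n]*n; %-distribˡ-+; m*n%n≡0; [m+kn]%n≡m%n)
open import Data.Nat.Tactic.RingSolver using (solve-∀)
open import Algebra.Properties.CommutativeSemigroup +-commutativeSemigroup using (x∙yz≈xz∙y; xy∙z≈x∙zy; xy∙z≈xz∙y)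
open import Data.Fin as Fin using (Fin; toℕ; fromℕ<; combine; remQuot; inject≤) renaming (_<_ to _<ᶠ_)
open import Data.Fin.Properties
  using ( injective⇒≤; combine-injective; combine-remQuot; fromℕ<-injective; toℕ-injective; toℕ<n
        ; toℕ-fromℕ<; toℕ-inject≤)
open import Data.List using (List; []; _∷_; length; lookup; filter; _++_; tabulate)
open import Data.List.Properties using (length-++; length-tabulate)
open import Data.List.Membership.Propositional using (_∈_; find; lose)
open import Data.List.Membership.Propositional.Properties using (∈-lookup; ∈-filter⁻; ∈-++⁻; ∈-tabulate⁻)
open import Data.List.Relation.Unary.All as All using ()
open import Data.List.Relation.Unary.Any using (any?)
open import Data.List.Relation.Unary.AllPairs using (_∷_)
open import Data.List.Relation.Unary.Unique.Propositional using (Unique)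
open import Data.List.Relation.Unary.Unique.Propositional.Properties using (filter⁺; ++⁺; tabulate⁺)
open import Data.Product using (Σ; _×_; _,_; proj₁; proj₂; uncurry)
open import Data.Sum using (_⊎_; inj₁; inj₂; fromInj₁)
open import Function using (_∘_)
open import Level using (0ℓ)
open import Relation.Nullary using (¬_; yes; no; contradiction)
open import Relation.Unary using (Pred; Decidable)
open import Relation.Unary.Properties using (∁?)
open import Relation.Binary.Definitions using (tri<; tri≈; tri>)
open import Relation.Binary.PropositionalEquality

_≈₁_ : ℕ → ℕ → Set
a ≈₁ b = a ≡ b ⊎ a ≡ suc b ⊎ b ≡ suc a

⌊a/2⌋≡⌊b/2⌋⇒a≈₁b : ∀ a b → ⌊ a /2⌋ ≡ ⌊ b /2⌋ → a ≈₁ b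
⌊a/2⌋≡⌊b/2⌋⇒a≈₁b zero          zero          _  = inj₁ refl
⌊a/2⌋≡⌊b/2⌋⇒a≈₁b zero          (suc zero)    _  = inj₂ (inj₂ refl)
⌊a/2⌋≡⌊b/2⌋⇒a≈₁b (suc zero)    zero          _  = inj₂ (inj₁ refl)
⌊a/2⌋≡⌊b/2⌋⇒a≈₁b (suc zero)    (suc zero)    _  = inj₁ refl
⌊a/2⌋≡⌊b/2⌋⇒a≈₁b (suc (suc a)) (suc (suc b)) eq with ⌊a/2⌋≡⌊b/2⌋⇒a≈₁b a b (suc-injective eq)
... | inj₁ a≡b          = inj₁ (cong (λ k → suc (suc k)) a≡b)
... | inj₂ (inj₁ a≡1+b) = inj₂ (inj₁ (cong (λ k → suc (suc k)) a≡1+b))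
... | inj₂ (inj₂ b≡1+a) = inj₂ (inj₂ (cong (λ k → suc (suc k)) b≡1+a))

pred-reflects-≈₁ : ∀ {a b} → a ≢ 0 → b ≢ 0 → pred a ≈₁ pred b → a ≈₁ b
pred-reflects-≈₁ {zero}  a≢0 _   _ = contradiction refl a≢0
pred-reflects-≈₁ {suc _} {zero} _ b≢0 _ = contradiction refl b≢0
pred-reflects-≈₁ {suc _} {suc _} _ _ (inj₁ eq)        = inj₁ (cong suc eq)
pred-reflects-≈₁ {suc _} {suc _} _ _ (inj₂ (inj₁ eq)) = inj₂ (inj₁ (cong suc eq))
pred-reflects-≈₁ {suc _} {suc _} _ _ (inj₂ (inj₂ eq)) = inj₂ (inj₂ (cong suc eq))

a<q+q⇒⌊a/2⌋<q : ∀ a q → a < q + q → ⌊ a /2⌋ < q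
a<q+q⇒⌊a/2⌋<q a             zero    ()
a<q+q⇒⌊a/2⌋<q zero          (suc q) _  = s≤s z≤n
a<q+q⇒⌊a/2⌋<q (suc zero)    (suc q) _  = s≤s z≤n
a<q+q⇒⌊a/2⌋<q (suc (suc a)) (suc q) (s≤s a+1<q+q) =
  s≤s (a<q+q⇒⌊a/2⌋<q a q (≤-pred (subst (suc (suc a) ≤_) (+-suc q q) a+1<q+q)))

a<1+K⇒pred[a]<K : ∀ {a K} → a ≢ 0 → a < suc K → pred a < K
a<1+K⇒pred[a]<K {zero}  a≢0 _ = contradiction refl a≢0
a<1+K⇒pred[a]<K {suc a} _   (s≤s a<K) = a<K

a+a≤b+b⇒a≤b : ∀ {a b} → a + a ≤ b + b → a ≤ b
a+a≤b+b⇒a≤b a+a≤b+b = ≮⇒≥ λ b<a → <⇒≱ (+-mono-< b<a b<a) a+a≤b+b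

a+a≤1+b+b⇒a≤b : ∀ {a b} → a + a ≤ suc (b + b) → a ≤ b
a+a≤1+b+b⇒a≤b {a} {b} a+a≤ = ≮⇒≥ λ b<a →
  <⇒≱ (subst (_≤ a + a) (+-suc (suc b) b) (+-mono-≤ b<a b<a)) a+a≤

double-plus-bit-injective : ∀ X₁ X₂ {b₁ b₂} → b₁ ≤ 1 → b₂ ≤ 1 →
  X₁ + (X₁ + b₁) ≡ X₂ + (X₂ + b₂) → X₁ ≡ X₂ × b₁ ≡ b₂
double-plus-bit-injective zero      zero      _    _    eq = refl , eq
double-plus-bit-injective zero      (suc X₂)  b₁≤1 _    eq =
  contradiction (subst (_≤ 0) (+-suc X₂ _) (≤-pred (subst (_≤ 1) eq b₁≤1))) λ ()
double-plus-bit-injective (suc X₁)  zero      _    b₂≤1 eq =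
  contradiction (subst (_≤ 0) (+-suc X₁ _) (≤-pred (subst (_≤ 1) (sym eq) b₂≤1))) λ ()
double-plus-bit-injective (suc X₁)  (suc X₂)  b₁≤1 b₂≤1 eq
  with double-plus-bit-injective X₁ X₂ b₁≤1 b₂≤1
         (suc-injective (trans (sym (+-suc X₁ _)) (trans (suc-injective eq) (+-suc X₂ _))))
... | X₁≡X₂ , b₁≡b₂ = cong suc X₁≡X₂ , b₁≡b₂

double≢suc-double : ∀ j j′ → j + j ≢ suc (j′ + j′)
double≢suc-double j j′ eq = even≢odd j j′ (begin
  2 * j              ≡⟨ cong (j +_) (+-identityʳ j) ⟩
  j + j              ≡⟨ eq ⟩
  suc (j′ + j′)      ≡⟨ cong (λ k → suc (j′ + k)) (+-identityʳ j′) ⟨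
  suc (2 * j′)       ∎)
  where open ≡-Reasoning

%2-cases : ∀ a → a % 2 ≡ 0 ⊎ a % 2 ≡ 1
%2-cases a with a % 2 | m%n<n a 2
... | 0 | _ = inj₁ refl
... | 1 | _ = inj₂ refl
... | suc (suc _) | s≤s (s≤s ())

%2≡0⇒double : ∀ k → k % 2 ≡ 0 → k ≡ k / 2 + k / 2
%2≡0⇒double k k%2≡0 = begin
  k                      ≡⟨ m≡m%n+[m/n]*n k 2 ⟩
  k % 2 + k / 2 * 2      ≡⟨ cong (_+ k / 2 * 2) k%2≡0 ⟩
  k / 2 * 2              ≡⟨ *-comm (k / 2) 2 ⟩
  k / 2 + (k / 2 + 0)    ≡⟨ cong (k / 2 +_) (+-identityʳ (k / 2)) ⟩
  k / 2 + k / 2          ∎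
  where open ≡-Reasoning

%2≡1⇒suc-double : ∀ k → k % 2 ≡ 1 → k ≡ suc (k / 2 + k / 2)
%2≡1⇒suc-double k k%2≡1 = begin
  k                      ≡⟨ m≡m%n+[m/n]*n k 2 ⟩
  k % 2 + k / 2 * 2      ≡⟨ cong (_+ k / 2 * 2) k%2≡1 ⟩
  suc (k / 2 * 2)        ≡⟨ cong suc (*-comm (k / 2) 2) ⟩
  suc (k / 2 + (k / 2 + 0)) ≡⟨ cong (λ h → suc (k / 2 + h)) (+-identityʳ (k / 2)) ⟩
  suc (k / 2 + k / 2)    ∎
  where open ≡-Reasoning

remQuot-injective : ∀ {q} n {k k′ : Fin (q * n)} → remQuot {q} n k ≡ remQuot {q} n k′ → k ≡ k′
remQuot-injective {q} n {k} {k′} eq = begin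
  k                                                 ≡⟨ combine-remQuot {q} n k ⟨
  uncurry (combine {q} {n}) (remQuot {q} n k)   ≡⟨ cong (uncurry combine) eq ⟩
  uncurry (combine {q} {n}) (remQuot {q} n k′)  ≡⟨ combine-remQuot {q} n k′ ⟩
  k′                                                ∎
  where open ≡-Reasoning

module _ {A : Set} where

  Unique⇒lookup-injective : ∀ {xs : List A} → Unique xs → ∀ {i j} → lookup xs i ≡ lookup xs j → i ≡ j
  Unique⇒lookup-injective (_ ∷ _) {Fin.zero} {Fin.zero} _ = refl
  Unique⇒lookup-injective (x∉xs ∷ _) {Fin.zero} {Fin.suc j} eq =
    contradiction eq (All.lookup x∉xs (∈-lookup j))
  Unique⇒lookup-injective (x∉xs ∷ _) {Fin.suc i} {Fin.zero} eq =
    contradiction (sym eq) (All.lookup x∉xs (∈-lookup i))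
  Unique⇒lookup-injective (_ ∷ u) {Fin.suc i} {Fin.suc j} eq = cong Fin.suc (Unique⇒lookup-injective u eq)

  injective-code⇒length≤ : ∀ {K} {xs : List A} → Unique xs → (code : ∀ {x} → x ∈ xs → Fin K) →
    (∀ {x y} (x∈ : x ∈ xs) (y∈ : y ∈ xs) → code x∈ ≡ code y∈ → x ≡ y) → length xs ≤ K
  injective-code⇒length≤ u code inj =
    injective⇒≤ (λ eq → Unique⇒lookup-injective u (inj (∈-lookup _) (∈-lookup _) eq))

  length-filter+∁ : ∀ {P : Pred A 0ℓ} (P? : Decidable P) xs →
    length xs ≡ length (filter P? xs) + length (filter (∁? P?) xs)
  length-filter+∁ P? [] = refl
  length-filter+∁ P? (x ∷ xs) with P? x
  ... | yes _ = cong suc (length-filter+∁ P? xs)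
  ... | no  _ = trans (cong suc (length-filter+∁ P? xs)) (sym (+-suc _ _))

  rank-position⇒length≤ : ∀ {xs : List A} (q N : ℕ) (rank pos : A → ℕ) → Unique xs →
    (∀ {x} → x ∈ xs → rank x < q + q) → (∀ {x} → x ∈ xs → pos x < N) →
    (∀ {x y} → x ∈ xs → y ∈ xs → pos x ≡ pos y → rank x ≈₁ rank y → x ≡ y) →
    length xs ≤ q * N
  rank-position⇒length≤ q N rank pos u rank< pos< collide = injective-code⇒length≤ u code inj
    where
    half : ∀ {x} → x ∈ _ → Fin q
    half {x} x∈ = fromℕ< (a<q+q⇒⌊a/2⌋<q (rank x) q (rank< x∈))
    cell : ∀ {x} → x ∈ _ → Fin N
    cell x∈ = fromℕ< (pos< x∈)
    code : ∀ {x} → x ∈ _ → Fin (q * N)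
    code x∈ = combine (half x∈) (cell x∈)
    inj : ∀ {x y} (x∈ : x ∈ _) (y∈ : y ∈ _) → code x∈ ≡ code y∈ → x ≡ y
    inj {x} {y} x∈ y∈ eq with combine-injective (half x∈) (cell x∈) (half y∈) (cell y∈) eq
    ... | half≡ , cell≡ = collide x∈ y∈ (fromℕ<-injective _ _ _ _ cell≡)
                            (⌊a/2⌋≡⌊b/2⌋⇒a≈₁b (rank x) (rank y) (fromℕ<-injective _ _ _ _ half≡))

  -- If some element has code 2m then no element has code 0, and the codes pair up as
  -- (1,2), (3,4), …, (2m−1,2m); otherwise as (0,1), …, (2m−2,2m−1).
  odd-cycle⇒length≤ : ∀ {xs : List A} (m : ℕ) (Adj : A → A → Set) (c : A → ℕ) → Unique xs →
    (∀ {x y} → x ∈ xs → y ∈ xs → ¬ Adj x y) →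
    (∀ {x} → x ∈ xs → c x ≤ m + m) →
    (∀ {x y} → x ∈ xs → y ∈ xs → c x ≡ c y → x ≡ y) →
    (∀ {x y} → x ∈ xs → y ∈ xs → c y ≡ suc (c x) → Adj x y) →
    (∀ {x y} → x ∈ xs → y ∈ xs → c x ≡ 0 → c y ≡ m + m → Adj x y) →
    length xs ≤ m
  odd-cycle⇒length≤ {xs} m Adj c u indep c≤ c-inj step wrap =
    subst (length xs ≤_) (*-identityʳ m) bound
    where
    collide : ∀ {x y} → x ∈ xs → y ∈ xs → c x ≈₁ c y → x ≡ y
    collide x∈ y∈ (inj₁ eq)        = c-inj x∈ y∈ eq
    collide x∈ y∈ (inj₂ (inj₁ eq)) = contradiction (step y∈ x∈ eq) (indep y∈ x∈)
    collide x∈ y∈ (inj₂ (inj₂ eq)) = contradiction (step x∈ y∈ eq) (indep x∈ y∈)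
    bound : length xs ≤ m * 1
    bound with any? (λ x → c x ≟ m + m) xs
    ... | no ¬top = rank-position⇒length≤ m 1 c (λ _ → 0) u
          (λ {x} x∈ → ≤∧≢⇒< (c≤ x∈) (λ eq → ¬top (lose x∈ eq))) (λ _ → s≤s z≤n)
          (λ x∈ y∈ _ → collide x∈ y∈)
    ... | yes top with find top
    ...   | w , w∈ , cw≡top = rank-position⇒length≤ m 1 (pred ∘ c) (λ _ → 0) u
          (λ x∈ → a<1+K⇒pred[a]<K (c≢0 x∈) (s≤s (c≤ x∈))) (λ _ → s≤s z≤n)
          (λ x∈ y∈ _ → collide x∈ y∈ ∘ pred-reflects-≈₁ (c≢0 x∈) (c≢0 y∈))
      where
      c≢0 : ∀ {x} → x ∈ xs → c x ≢ 0
      c≢0 x∈ cx≡0 = indep x∈ w∈ (wrap x∈ w∈ cx≡0 cw≡top)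

module Chords (n m : ℕ) (2m≤n : m + m ≤ n) (n≤2m+1 : n ≤ suc (m + m)) (1≤m : 1 ≤ m) where

  2≤n : 2 ≤ n
  2≤n = ≤-trans (+-mono-≤ 1≤m 1≤m) 2m≤n

  m≤n : m ≤ n
  m≤n = ≤-trans (m≤m+n m m) 2m≤n

  ‖_‖ : ℕ → ℕ
  ‖ e ‖ with e + e ≤? n
  ... | yes _ = e
  ... | no  _ = n ∸ e

  ‖‖-cases : ∀ e → e ≤ n → (e + e ≤ n × ‖ e ‖ ≡ e) ⊎ (n < e + e × ‖ e ‖ + e ≡ n)
  ‖‖-cases e e≤n with e + e ≤? n
  ... | yes 2e≤n = inj₁ (2e≤n , refl)
  ... | no  2e≰n = inj₂ (≰⇒> 2e≰n , m∸n+n≡m e≤n)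

  ‖‖-short : ∀ {e} → e + e ≤ n → ‖ e ‖ ≡ e
  ‖‖-short {e} 2e≤n with e + e ≤? n
  ... | yes _   = refl
  ... | no 2e≰n = contradiction 2e≤n 2e≰n

  ‖1‖≡1 : ‖ 1 ‖ ≡ 1
  ‖1‖≡1 = ‖‖-short 2≤n

  ‖‖-range : ∀ e → 1 ≤ e → e < n → 1 ≤ ‖ e ‖ × ‖ e ‖ ≤ m
  ‖‖-range e 1≤e e<n with ‖‖-cases e (<⇒≤ e<n)
  ... | inj₁ (2e≤n , ‖e‖≡e) rewrite ‖e‖≡e = 1≤e , a+a≤1+b+b⇒a≤b (≤-trans 2e≤n n≤2m+1)
  ... | inj₂ (n<2e , ‖e‖+e≡n) = 1≤‖e‖ , a+a≤b+b⇒a≤b (≤-pred (≤-trans 1+2‖e‖≤n n≤2m+1))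
    where
    ‖e‖<e : ‖ e ‖ < e
    ‖e‖<e = +-cancelʳ-< e ‖ e ‖ e (subst (_< e + e) (sym ‖e‖+e≡n) n<2e)
    1+2‖e‖≤n : suc (‖ e ‖ + ‖ e ‖) ≤ n
    1+2‖e‖≤n = subst (suc (‖ e ‖ + ‖ e ‖) ≤_) ‖e‖+e≡n (+-monoʳ-< ‖ e ‖ ‖e‖<e)
    1≤‖e‖ : 1 ≤ ‖ e ‖
    1≤‖e‖ = n≢0⇒n>0 λ ‖e‖≡0 → <⇒≢ e<n (trans (cong (_+ e) (sym ‖e‖≡0)) ‖e‖+e≡n)

  ‖‖-of-complement : ∀ {e f} → e + e ≤ n → e + f ≡ n → ‖ f ‖ ≡ e
  ‖‖-of-complement {e} {f} 2e≤n e+f≡n with ‖‖-cases f (subst (f ≤_) e+f≡n (m≤n+m f e))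
  ... | inj₁ (2f≤n , ‖f‖≡f) = trans ‖f‖≡f (≤-antisym f≤e e≤f)
    where
    e≤f : e ≤ f
    e≤f = +-cancelˡ-≤ e e f (subst (e + e ≤_) (sym e+f≡n) 2e≤n)
    f≤e : f ≤ e
    f≤e = +-cancelʳ-≤ f f e (subst (f + f ≤_) (sym e+f≡n) 2f≤n)
  ... | inj₂ (_ , ‖f‖+f≡n) = +-cancelʳ-≡ f _ _ (trans ‖f‖+f≡n (sym e+f≡n))

  ‖‖-complement : ∀ e f → e + f ≡ n → ‖ e ‖ ≡ ‖ f ‖
  ‖‖-complement e f e+f≡n with ≤-total e f
  ... | inj₁ e≤f = trans (‖‖-short 2e≤n) (sym (‖‖-of-complement {e} {f} 2e≤n e+f≡n))
    where
    2e≤n : e + e ≤ n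
    2e≤n = subst (e + e ≤_) e+f≡n (+-monoʳ-≤ e e≤f)
  ... | inj₂ f≤e = trans (‖‖-of-complement {f} {e} 2f≤n (trans (+-comm f e) e+f≡n)) (sym (‖‖-short {f} 2f≤n))
    where
    2f≤n : f + f ≤ n
    2f≤n = subst (f + f ≤_) (trans (+-comm f e) e+f≡n) (+-monoʳ-≤ f f≤e)

  DistanceStep : ℕ → ℕ → Set
  DistanceStep d₁ d₂ = d₂ ≡ suc d₁ ⊎ d₁ ≡ suc d₂ ⊎ (d₁ ≡ m × d₂ ≡ m)

  ‖‖-suc : ∀ d → suc d < n → DistanceStep ‖ d ‖ ‖ suc d ‖
  ‖‖-suc d 1+d<n with ‖‖-cases d (≤-trans (n≤1+n d) (<⇒≤ 1+d<n)) | ‖‖-cases (suc d) (<⇒≤ 1+d<n)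
  ... | inj₁ (_ , ‖d‖≡d) | inj₁ (_ , ‖1+d‖≡1+d) = inj₁ (trans ‖1+d‖≡1+d (cong suc (sym ‖d‖≡d)))
  ... | inj₂ (_ , ‖d‖+d≡n) | inj₂ (_ , ‖1+d‖+1+d≡n) =
    inj₂ (inj₁ (+-cancelʳ-≡ d _ _ (trans ‖d‖+d≡n (trans (sym ‖1+d‖+1+d≡n) (+-suc _ d)))))
  ... | inj₂ (n<2d , _) | inj₁ (2+2d≤n , _) =
    contradiction (≤-trans (m≤n+m (d + d) 2) (subst (_≤ n) (cong suc (+-suc d d)) 2+2d≤n)) (<⇒≱ n<2d)
  ... | inj₁ (2d≤n , ‖d‖≡d) | inj₂ (n<2+2d , ‖1+d‖+1+d≡n)
    with m<1+n⇒m<n∨m≡n (subst (n <_) (cong suc (+-suc d d)) n<2+2d)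
  ...   | inj₁ n<1+2d = inj₂ (inj₁ (trans ‖d‖≡d (+-cancelʳ-≡ d _ _ (begin
            d + d                 ≡⟨ ≤-antisym 2d≤n (≤-pred n<1+2d) ⟩
            n                     ≡⟨ ‖1+d‖+1+d≡n ⟨
            ‖ suc d ‖ + suc d     ≡⟨ +-suc ‖ suc d ‖ d ⟩
            suc ‖ suc d ‖ + d     ∎))))
    where open ≡-Reasoning
  ...   | inj₂ n≡1+2d = inj₂ (inj₂ (trans ‖d‖≡d (sym m≡d) , trans ‖1+d‖≡d (sym m≡d)))
    where
    ‖1+d‖≡d : ‖ suc d ‖ ≡ d
    ‖1+d‖≡d = +-cancelʳ-≡ d _ _ (suc-injective (trans (sym (+-suc ‖ suc d ‖ d)) (trans ‖1+d‖+1+d≡n n≡1+2d)))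
    m≡d : m ≡ d
    m≡d = ≤-antisym (a+a≤1+b+b⇒a≤b (subst (m + m ≤_) n≡1+2d 2m≤n))
                    (a+a≤b+b⇒a≤b (≤-pred (subst (_≤ suc (m + m)) n≡1+2d n≤2m+1)))

  offset : ℕ → ℕ → ℕ
  offset A B with A <? B
  ... | yes _ = B ∸ A
  ... | no  _ = (n ∸ A) + B

  offset-< : ∀ {A B} → A < B → A + offset A B ≡ B
  offset-< {A} {B} A<B with A <? B
  ... | yes _   = m+[n∸m]≡n (<⇒≤ A<B)
  ... | no A≮B = contradiction A<B A≮B

  offset-> : ∀ {A B} → B < A → A < n → offset A B + A ≡ n + B
  offset-> {A} {B} B<A A<n with A <? B
  ... | yes A<B = contradiction A<B (<-asym B<A)
  ... | no _    = begin
    n ∸ A + B + A    ≡⟨ +-assoc (n ∸ A) B A ⟩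
    n ∸ A + (B + A)  ≡⟨ cong (n ∸ A +_) (+-comm B A) ⟩
    n ∸ A + (A + B)  ≡⟨ +-assoc (n ∸ A) A B ⟨
    n ∸ A + A + B    ≡⟨ cong (_+ B) (m∸n+n≡m (<⇒≤ A<n)) ⟩
    n + B            ∎
    where open ≡-Reasoning

  offset<n : ∀ {A B} → A < n → B < n → A ≢ B → offset A B < n
  offset<n {A} {B} A<n B<n A≢B with <-cmp A B
  ... | tri< A<B _ _ = ≤-<-trans (subst (offset A B ≤_) (offset-< A<B) (m≤n+m _ A)) B<n
  ... | tri≈ _ A≡B _ = contradiction A≡B A≢B
  ... | tri> _ _ B<A = +-cancelʳ-< A _ _ (subst (_< n + A) (sym (offset-> B<A A<n)) (+-monoʳ-< n B<A))

  offset-next : ∀ {B C} → B < n → Next n B C → offset B C ≡ 1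
  offset-next {B} _ (inj₁ refl) = +-cancelˡ-≡ B _ 1 (trans (offset-< (n<1+n B)) (+-comm 1 B))
  offset-next {B} B<n (inj₂ (1+B≡n , refl)) =
    +-cancelʳ-≡ B _ 1 (trans (offset-> 0<B B<n) (trans (+-identityʳ n) (sym 1+B≡n)))
    where
    0<B : 0 < B
    0<B = +-cancelˡ-< 1 0 B (subst (1 <_) (sym 1+B≡n) 2≤n)

  offset-suc : ∀ {A B C} → A < n → Next n B C → A ≢ B → A ≢ C → offset A C ≡ suc (offset A B)
  offset-suc {A} {B} A<n (inj₁ refl) A≢B A≢1+B with <-cmp A B
  ... | tri< A<B _ _ = +-cancelˡ-≡ A _ _ (begin
    A + offset A (suc B)   ≡⟨ offset-< (m<n⇒m<1+n A<B) ⟩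
    suc B                  ≡⟨ cong suc (offset-< A<B) ⟨
    suc (A + offset A B)   ≡⟨ +-suc A (offset A B) ⟨
    A + suc (offset A B)   ∎)
    where open ≡-Reasoning
  ... | tri≈ _ A≡B _ = contradiction A≡B A≢B
  ... | tri> _ _ B<A = +-cancelʳ-≡ A _ _ (begin
    offset A (suc B) + A   ≡⟨ offset-> (≤∧≢⇒< B<A (A≢1+B ∘ sym)) A<n ⟩
    n + suc B              ≡⟨ +-suc n B ⟩
    suc (n + B)            ≡⟨ cong suc (offset-> B<A A<n) ⟨
    suc (offset A B + A)   ∎)
    where open ≡-Reasoning
  offset-suc {A} {B} A<n (inj₂ (1+B≡n , refl)) A≢B A≢0 = +-cancelʳ-≡ A _ _ (begin
    offset A 0 + A         ≡⟨ offset-> (n≢0⇒n>0 A≢0) A<n ⟩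
    n + 0                  ≡⟨ trans (+-identityʳ n) (sym 1+B≡n) ⟩
    suc B                  ≡⟨ cong suc (offset-< A<B) ⟨
    suc (A + offset A B)   ≡⟨ cong suc (+-comm A (offset A B)) ⟩
    suc (offset A B + A)   ∎)
    where
    open ≡-Reasoning
    A<B : A < B
    A<B = ≤∧≢⇒< (≤-pred (subst (A <_) (sym 1+B≡n) A<n)) A≢B

  ‖offset‖-< : ∀ {A B} → A < B → ‖ offset A B ‖ ≡ ‖ B ∸ A ‖
  ‖offset‖-< {A} {B} A<B = cong ‖_‖ (+-cancelˡ-≡ A _ _ (trans (offset-< A<B) (sym (m+[n∸m]≡n (<⇒≤ A<B)))))

  ‖offset‖-> : ∀ {A B} → A < B → B < n → ‖ offset B A ‖ ≡ ‖ B ∸ A ‖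
  ‖offset‖-> {A} {B} A<B B<n = ‖‖-complement (offset B A) (B ∸ A) (+-cancelʳ-≡ A _ _ (begin
    offset B A + (B ∸ A) + A   ≡⟨ +-assoc (offset B A) (B ∸ A) A ⟩
    offset B A + (B ∸ A + A)   ≡⟨ cong (offset B A +_) (m∸n+n≡m (<⇒≤ A<B)) ⟩
    offset B A + B             ≡⟨ offset-> A<B B<n ⟩
    n + A                      ∎))
    where open ≡-Reasoning

  next-wrap : ∀ {Y X} → Y < n → suc Y ≡ n + X → Next n Y X
  next-wrap {X = zero}  _   1+Y≡n   = inj₂ (trans 1+Y≡n (+-identityʳ n) , refl)
  next-wrap {X = suc X} Y<n 1+Y≡n+1+X =
    contradiction (subst (n <_) (sym 1+Y≡n+1+X) (m<m+n n z<s)) (<⇒≱ Y<n ∘ ≤-pred)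

  -- The end of the chord {X, Y} from which its shorter arc runs forward (X on a tie).
  anchor : ℕ → ℕ → ℕ
  anchor X Y with (Y ∸ X) + (Y ∸ X) ≤? n
  ... | yes _ = X
  ... | no  _ = Y

  anchor-short : ∀ {X Y} → (Y ∸ X) + (Y ∸ X) ≤ n → anchor X Y ≡ X
  anchor-short {X} {Y} 2e≤n with (Y ∸ X) + (Y ∸ X) ≤? n
  ... | yes _    = refl
  ... | no 2e≰n = contradiction 2e≤n 2e≰n

  anchor-long : ∀ {X Y} → n < (Y ∸ X) + (Y ∸ X) → anchor X Y ≡ Y
  anchor-long {X} {Y} n<2e with (Y ∸ X) + (Y ∸ X) ≤? n
  ... | yes 2e≤n = contradiction 2e≤n (<⇒≱ n<2e)
  ... | no _     = refl

  -- {X, Y} = {a, a + d} in ℤₙ; an outer arc wraps past 0.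
  data Arc (a d X Y : ℕ) : Set where
    inner : X ≡ a → a + d ≡ Y     → Arc a d X Y
    outer : Y ≡ a → a + d ≡ n + X → d + d < n → Arc a d X Y

  arc-of : ∀ {X Y} → X < Y → Y < n → Arc (anchor X Y) ‖ Y ∸ X ‖ X Y
  arc-of {X} {Y} X<Y Y<n with (Y ∸ X) + (Y ∸ X) ≤? n
  ... | yes _ = inner refl (m+[n∸m]≡n (<⇒≤ X<Y))
  ... | no 2e≰n = outer refl (begin
    Y + (n ∸ e)           ≡⟨ cong (_+ (n ∸ e)) (m+[n∸m]≡n (<⇒≤ X<Y)) ⟨
    X + e + (n ∸ e)       ≡⟨ +-assoc X e (n ∸ e) ⟩
    X + (e + (n ∸ e))     ≡⟨ cong (X +_) (m+[n∸m]≡n e≤n) ⟩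
    X + n                 ≡⟨ +-comm X n ⟩
    n + X                 ∎) 2f<n
    where
    open ≡-Reasoning
    e f : ℕ
    e = Y ∸ X
    f = n ∸ e
    e≤n : e ≤ n
    e≤n = ≤-trans (m∸n≤m Y X) (<⇒≤ Y<n)
    f<e : f < e
    f<e = +-cancelʳ-< e f e (subst (_< e + e) (sym (m∸n+n≡m e≤n)) (≰⇒> 2e≰n))
    2f<n : f + f < n
    2f<n = subst (f + f <_) (m∸n+n≡m e≤n) (+-monoʳ-< f f<e)

  arc-injective : ∀ {a d X₁ Y₁ X₂ Y₂} → Arc a d X₁ Y₁ → Arc a d X₂ Y₂ → Y₁ < n → Y₂ < n →
    X₁ ≡ X₂ × Y₁ ≡ Y₂
  arc-injective (inner refl refl) (inner refl refl) _ _ = refl , refl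
  arc-injective {X₁ = X₁} (outer refl eq₁ _) (outer refl eq₂ _) _ _ =
    +-cancelˡ-≡ n X₁ _ (trans (sym eq₁) eq₂) , refl
  arc-injective {X₂ = X₂} (inner refl eq₁) (outer refl eq₂ _) Y₁<n _ =
    contradiction (subst (n ≤_) (trans (sym eq₂) eq₁) (m≤m+n n X₂)) (<⇒≱ Y₁<n)
  arc-injective {X₁ = X₁} (outer refl eq₁ _) (inner refl eq₂) _ Y₂<n =
    contradiction (subst (n ≤_) (trans (sym eq₁) eq₂) (m≤m+n n X₁)) (<⇒≱ Y₂<n)

  arc-suc : ∀ {a d X₁ Y₁ X₂ Y₂} → Arc a d X₁ Y₁ → Arc a (suc d) X₂ Y₂ → Y₁ < n → Y₂ < n →
    (X₁ ≡ X₂ × Next n Y₁ Y₂) ⊎ (X₁ ≡ Y₂ × Next n Y₁ X₂) ⊎ (Y₁ ≡ Y₂ × Next n X₁ X₂)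
  arc-suc {a} {d} (inner refl refl) (inner refl refl) _ _ = inj₁ (refl , inj₁ (sym (+-suc a d)))
  arc-suc {a} {d} (inner refl refl) (outer refl eq _) Y₁<n _ =
    inj₂ (inj₁ (refl , next-wrap Y₁<n (trans (sym (+-suc a d)) eq)))
  arc-suc {a} {d} {X₁ = X₁} (outer refl eq _) (inner refl refl) _ Y₂<n =
    contradiction (≤-trans (subst (n ≤_) (sym eq) (m≤m+n n X₁)) (n≤1+n (a + d)))
                  (<⇒≱ (subst (_< n) (+-suc a d) Y₂<n))
  arc-suc {a} {d} {X₁ = X₁} {X₂ = X₂} (outer refl eq₁ _) (outer refl eq₂ _) _ _ =
    inj₂ (inj₂ (refl , inj₁ (+-cancelˡ-≡ n _ _ (begin
      n + suc X₁     ≡⟨ +-suc n X₁ ⟩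
      suc (n + X₁)   ≡⟨ cong suc eq₁ ⟨
      suc (a + d)    ≡⟨ +-suc a d ⟨
      a + suc d      ≡⟨ eq₂ ⟩
      n + X₂         ∎))))
    where open ≡-Reasoning

  inner-chord-coords : ∀ {X d} → d + d ≤ n → anchor X (X + d) ≡ X × ‖ X + d ∸ X ‖ ≡ d
  inner-chord-coords {X} {d} 2d≤n =
    anchor-short {X} {X + d} (subst (λ e → e + e ≤ n) (sym e≡d) 2d≤n) , trans (cong ‖_‖ e≡d) (‖‖-short 2d≤n)
    where
    e≡d : X + d ∸ X ≡ d
    e≡d = m+n∸m≡n X d

  outer-chord-coords : ∀ {X Y d} → X < Y → Y + d ≡ n + X → d + d < n → anchor X Y ≡ Y × ‖ Y ∸ X ‖ ≡ d
  outer-chord-coords {X} {Y} {d} X<Y Y+d≡n+X 2d<n =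
    anchor-long {X} {Y} n<2e , ‖‖-of-complement (<⇒≤ 2d<n) (trans (+-comm d e) e+d≡n)
    where
    e : ℕ
    e = Y ∸ X
    e+d≡n : e + d ≡ n
    e+d≡n = +-cancelˡ-≡ X _ _ (begin
      X + (e + d)    ≡⟨ +-assoc X e d ⟨
      X + e + d      ≡⟨ cong (_+ d) (m+[n∸m]≡n (<⇒≤ X<Y)) ⟩
      Y + d          ≡⟨ Y+d≡n+X ⟩
      n + X          ≡⟨ +-comm n X ⟩
      X + n          ∎)
      where open ≡-Reasoning
    d<e : d < e
    d<e = +-cancelʳ-< d d e (subst (d + d <_) (sym e+d≡n) 2d<n)
    n<2e : n < e + e
    n<2e = subst (_< e + e) e+d≡n (+-monoʳ-< e d<e)

module Coordinates (n p m : ℕ) (2m≤n : m + m ≤ n) (n≤2m+1 : n ≤ suc (m + m)) (1≤m : 1 ≤ m) where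
  open Chords n m 2m≤n n≤2m+1 1≤m

  dist : Fin n → Fin n → ℕ
  dist x y = ‖ toℕ y ∸ toℕ x ‖

  lev : Vtx n p → ℕ
  lev (base x y _) = m ∸ dist x y
  lev (layer k _)  = m + toℕ k

  pos : Vtx n p → ℕ
  pos (base x y _) = anchor (toℕ x) (toℕ y)
  pos (layer _ i)  = toℕ i

  dist-range : ∀ {x y : Fin n} → x <ᶠ y → 1 ≤ dist x y × dist x y ≤ m
  dist-range {x} {y} x<y = ‖‖-range (toℕ y ∸ toℕ x) (m<n⇒0<n∸m x<y) (≤-<-trans (m∸n≤m (toℕ y) (toℕ x)) (toℕ<n y))

  lev-base : ∀ {x y} (x<y : x <ᶠ y) → lev (base x y x<y) + dist x y ≡ m
  lev-base x<y = m∸n+n≡m (proj₂ (dist-range x<y))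

  lev-base<m : ∀ {x y} (x<y : x <ᶠ y) → lev (base x y x<y) < m
  lev-base<m x<y = ∸-monoʳ-< (proj₁ (dist-range x<y)) (proj₂ (dist-range x<y))

  base-arc : ∀ {x y} (x<y : x <ᶠ y) → Arc (pos (base x y x<y)) (dist x y) (toℕ x) (toℕ y)
  base-arc {y = y} x<y = arc-of x<y (toℕ<n y)

  lev< : ∀ u → lev u < m + p
  lev< (base _ _ x<y) = ≤-trans (lev-base<m x<y) (m≤m+n m p)
  lev< (layer k _)    = +-monoʳ-< m (toℕ<n k)

  pos< : ∀ u → pos u < n
  pos< (base x y x<y) with base-arc x<y
  ... | inner x≡a _   = subst (_< n) x≡a (toℕ<n x)
  ... | outer y≡a _ _ = subst (_< n) y≡a (toℕ<n y)
  pos< (layer _ i) = toℕ<n i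

  base-≡ : ∀ {x₁ y₁ x₂ y₂ : Fin n} (h₁ : x₁ <ᶠ y₁) (h₂ : x₂ <ᶠ y₂) →
    toℕ x₁ ≡ toℕ x₂ → toℕ y₁ ≡ toℕ y₂ → base {n} {p} x₁ y₁ h₁ ≡ base x₂ y₂ h₂
  base-≡ h₁ h₂ x₁≡x₂ y₁≡y₂ with toℕ-injective x₁≡x₂ | toℕ-injective y₁≡y₂
  ... | refl | refl = cong (base _ _) (<-irrelevant h₁ h₂)

  dist-injective : ∀ {x₁ y₁ x₂ y₂ : Fin n} (h₁ : x₁ <ᶠ y₁) (h₂ : x₂ <ᶠ y₂) →
    lev (base x₁ y₁ h₁) ≡ lev (base x₂ y₂ h₂) → dist x₁ y₁ ≡ dist x₂ y₂
  dist-injective h₁ h₂ = ∸-cancelˡ-≡ (proj₂ (dist-range h₁)) (proj₂ (dist-range h₂))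

  layer-above-base : ∀ {x y} (x<y : x <ᶠ y) k i → lev (base x y x<y) < lev (layer k i)
  layer-above-base x<y k _ = ≤-trans (lev-base<m x<y) (m≤m+n m (toℕ k))

  coords-injective : ∀ u v → lev u ≡ lev v → pos u ≡ pos v → u ≡ v
  coords-injective (base x₁ y₁ h₁) (base x₂ y₂ h₂) lev≡ pos≡ =
    uncurry (base-≡ h₁ h₂) (arc-injective (base-arc h₁) arc₂ (toℕ<n y₁) (toℕ<n y₂))
    where
    arc₂ : Arc (pos (base x₁ y₁ h₁)) (dist x₁ y₁) (toℕ x₂) (toℕ y₂)
    arc₂ = subst₂ (λ a d → Arc a d (toℕ x₂) (toℕ y₂)) (sym pos≡) (sym (dist-injective h₁ h₂ lev≡)) (base-arc h₂)
  coords-injective (base _ _ h) (layer k i) lev≡ _ = contradiction lev≡ (<⇒≢ (layer-above-base h k i))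
  coords-injective (layer k i) (base _ _ h) lev≡ _ = contradiction (sym lev≡) (<⇒≢ (layer-above-base h k i))
  coords-injective (layer k i) (layer l j) lev≡ pos≡ =
    cong₂ layer (toℕ-injective (+-cancelˡ-≡ m _ _ lev≡)) (toℕ-injective pos≡)

  layer-down : ∀ {k l : Fin p} {i : Fin n} → toℕ k ≡ suc (toℕ l) → Down (layer k i) (layer l i)
  layer-down {k} k≡1+l with %2-cases (toℕ k)
  ... | inj₁ even = dOddA k≡1+l even
  ... | inj₂ odd  = dEvenA k≡1+l odd

  layer-over-base : ∀ {k : Fin p} {i x y} (h : x <ᶠ y) →
    lev (layer k i) ≡ suc (lev (base x y h)) → toℕ k ≡ 0 × dist x y ≡ 1
  layer-over-base {x = x} {y} h lev≡ = step-from-below (proj₁ (dist-range h)) (lev-base h) lev≡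
    where
    step-from-below : ∀ {l d k} → 1 ≤ d → l + d ≡ m → m + k ≡ suc l → k ≡ 0 × d ≡ 1
    step-from-below {l} {suc d} {k} _ l+d≡m m+k≡1+l = m+n≡0⇒n≡0 d d+k≡0 , cong suc (m+n≡0⇒m≡0 d d+k≡0)
      where
      d+k≡0 : d + k ≡ 0
      d+k≡0 = suc-injective (+-cancelˡ-≡ l _ _ (begin
        l + (suc d + k)   ≡⟨ +-assoc l (suc d) k ⟨
        l + suc d + k     ≡⟨ cong (_+ k) l+d≡m ⟩
        m + k             ≡⟨ m+k≡1+l ⟩
        suc l             ≡⟨ +-comm 1 l ⟩
        l + 1             ∎))
        where open ≡-Reasoning

  stacked-adjacent : ∀ u v → lev u ≡ suc (lev v) → pos u ≡ pos v → Adj u v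
  stacked-adjacent (base x₁ y₁ h₁) (base x₂ y₂ h₂) lev≡ pos≡
    with arc-suc (base-arc h₁) (subst₂ (λ a d → Arc a d _ _) (sym pos≡) dist≡ (base-arc h₂)) (toℕ<n y₁) (toℕ<n y₂)
    where
    dist≡ : dist x₂ y₂ ≡ suc (dist x₁ y₁)
    dist≡ = +-cancelˡ-≡ (lev (base x₂ y₂ h₂)) _ _ (begin
      lev (base x₂ y₂ h₂) + dist x₂ y₂         ≡⟨ trans (lev-base h₂) (sym (lev-base h₁)) ⟩
      lev (base x₁ y₁ h₁) + dist x₁ y₁         ≡⟨ cong (_+ dist x₁ y₁) lev≡ ⟩
      suc (lev (base x₂ y₂ h₂)) + dist x₁ y₁   ≡⟨ +-suc _ (dist x₁ y₁) ⟨
      lev (base x₂ y₂ h₂) + suc (dist x₁ y₁)   ∎)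
      where open ≡-Reasoning
  ... | inj₁ (x₁≡x₂ , next) =
    tok x₁ y₁ y₂ (inj₁ (refl , refl)) (inj₁ (toℕ-injective (sym x₁≡x₂) , refl)) (inj₁ next)
  ... | inj₂ (inj₁ (x₁≡y₂ , next)) =
    tok x₁ y₁ x₂ (inj₁ (refl , refl)) (inj₂ (refl , toℕ-injective (sym x₁≡y₂))) (inj₁ next)
  ... | inj₂ (inj₂ (y₁≡y₂ , next)) =
    tok y₁ x₁ x₂ (inj₂ (refl , refl)) (inj₂ (refl , toℕ-injective (sym y₁≡y₂))) (inj₁ next)
  stacked-adjacent (base _ _ h) (layer k i) lev≡ _ =
    contradiction (subst (_< lev (layer k i)) lev≡ (layer-above-base h k i)) (<⇒≱ (n≤1+n _))
  stacked-adjacent (layer k i) (layer l j) lev≡ pos≡ with toℕ-injective {i = i} {j = j} pos≡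
  ... | refl = down (layer-down (+-cancelˡ-≡ m _ _ (trans lev≡ (sym (+-suc m (toℕ l))))))
  stacked-adjacent (layer k i) (base x y h) lev≡ pos≡ with layer-over-base {k} {i} h lev≡
  ... | k≡0 , d≡1 with subst₂ (λ a d → Arc a d _ _) (sym pos≡) d≡1 (base-arc h)
  ...   | inner x≡i i+1≡y =
    down (d1a k≡0 (inj₁ (trans (+-comm 1 (toℕ i)) i+1≡y)) (inj₁ (toℕ-injective x≡i , refl)))
  ...   | outer y≡i i+1≡n+x _ =
    down (d1a k≡0 (next-wrap (toℕ<n i) (trans (+-comm 1 (toℕ i)) i+1≡n+x)) (inj₂ (refl , toℕ-injective y≡i)))

  rep-dist : ∀ {x y a b : Fin n} (h : x <ᶠ y) → Rep x y a b → ‖ offset (toℕ a) (toℕ b) ‖ ≡ dist x y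
  rep-dist h       (inj₁ (refl , refl)) = ‖offset‖-< h
  rep-dist {y = y} h (inj₂ (refl , refl)) = ‖offset‖-> h (toℕ<n y)

  rep-≢ : ∀ {x y a b : Fin n} → x <ᶠ y → Rep x y a b → toℕ a ≢ toℕ b
  rep-≢ h (inj₁ (refl , refl)) = <⇒≢ h
  rep-≢ h (inj₂ (refl , refl)) = <⇒≢ h ∘ sym

  lev-suc : ∀ {l₁ d₁ l₂ d₂} → l₁ + d₁ ≡ m → l₂ + d₂ ≡ m → d₂ ≡ suc d₁ → l₁ ≡ suc l₂
  lev-suc {d₁ = d₁} {l₂} refl l₂+d₂≡m refl = +-cancelʳ-≡ d₁ _ _ (trans (sym l₂+d₂≡m) (+-suc l₂ d₁))

  below-first-layer : ∀ {k : Fin p} {i x y} (h : x <ᶠ y) → toℕ k ≡ 0 → dist x y ≡ 1 →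
    lev (layer k i) ≡ suc (lev (base x y h))
  below-first-layer {k} {x = x} {y} h k≡0 d≡1 = begin
    m + toℕ k                        ≡⟨ trans (cong (m +_) k≡0) (+-identityʳ m) ⟩
    m                                ≡⟨ lev-base h ⟨
    lev (base x y h) + dist x y      ≡⟨ cong (lev (base x y h) +_) d≡1 ⟩
    lev (base x y h) + 1             ≡⟨ +-comm _ 1 ⟩
    suc (lev (base x y h))           ∎
    where open ≡-Reasoning

  unit-dist : ∀ {x y a b : Fin n} (h : x <ᶠ y) → Rep x y a b → Next n (toℕ a) (toℕ b) → dist x y ≡ 1
  unit-dist {x} {y} {a} {b} h rep next = begin
    dist x y                      ≡⟨ rep-dist h rep ⟨
    ‖ offset (toℕ a) (toℕ b) ‖    ≡⟨ cong ‖_‖ (offset-next (toℕ<n a) next) ⟩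
    ‖ 1 ‖                         ≡⟨ ‖1‖≡1 ⟩
    1                             ∎
    where open ≡-Reasoning

  down-lev : ∀ {u v} → Down u v → lev u ≡ suc (lev v)
  down-lev (d1a {k = k} {i} {x<y = h} k≡0 next rep) = below-first-layer {k} {i} h k≡0 (unit-dist h rep next)
  down-lev (d1b {k = k} {i} {x<y = h} k≡0 next rep) = below-first-layer {k} {i} h k≡0 (unit-dist h rep next)
  down-lev (dOddA  k≡1+l _)   = trans (cong (m +_) k≡1+l) (+-suc m _)
  down-lev (dOddB  k≡1+l _ _) = trans (cong (m +_) k≡1+l) (+-suc m _)
  down-lev (dEvenA k≡1+l _)   = trans (cong (m +_) k≡1+l) (+-suc m _)
  down-lev (dEvenB k≡1+l _ _) = trans (cong (m +_) k≡1+l) (+-suc m _)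

  NeighbourLevels : ℕ → ℕ → Set
  NeighbourLevels a b = a ≡ suc b ⊎ b ≡ suc a ⊎ (a ≡ 0 × b ≡ 0)

  NeighbourLevels-sym : ∀ {a b} → NeighbourLevels a b → NeighbourLevels b a
  NeighbourLevels-sym (inj₁ a≡1+b)              = inj₂ (inj₁ a≡1+b)
  NeighbourLevels-sym (inj₂ (inj₁ b≡1+a))       = inj₁ b≡1+a
  NeighbourLevels-sym (inj₂ (inj₂ (a≡0 , b≡0))) = inj₂ (inj₂ (b≡0 , a≡0))

  distance-step-levels : ∀ {x₁ y₁ x₂ y₂ : Fin n} (h₁ : x₁ <ᶠ y₁) (h₂ : x₂ <ᶠ y₂) →
    DistanceStep (dist x₁ y₁) (dist x₂ y₂) → NeighbourLevels (lev (base x₁ y₁ h₁)) (lev (base x₂ y₂ h₂))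
  distance-step-levels h₁ h₂ (inj₁ d₂≡1+d₁)        = inj₁ (lev-suc (lev-base h₁) (lev-base h₂) d₂≡1+d₁)
  distance-step-levels h₁ h₂ (inj₂ (inj₁ d₁≡1+d₂)) = inj₂ (inj₁ (lev-suc (lev-base h₂) (lev-base h₁) d₁≡1+d₂))
  distance-step-levels h₁ h₂ (inj₂ (inj₂ (d₁≡m , d₂≡m))) =
    inj₂ (inj₂ (trans (cong (m ∸_) d₁≡m) (n∸n≡0 m) , trans (cong (m ∸_) d₂≡m) (n∸n≡0 m)))

  token-step : ∀ {x₁ y₁ x₂ y₂ a b c : Fin n} (h₁ : x₁ <ᶠ y₁) (h₂ : x₂ <ᶠ y₂) →
    Rep x₁ y₁ a b → Rep x₂ y₂ a c → Next n (toℕ b) (toℕ c) →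
    NeighbourLevels (lev (base x₁ y₁ h₁)) (lev (base x₂ y₂ h₂))
  token-step {x₁} {y₁} {x₂} {y₂} {a} {b} {c} h₁ h₂ rep₁ rep₂ next =
    distance-step-levels h₁ h₂ (subst₂ DistanceStep (rep-dist h₁ rep₁) d₂≡ (‖‖-suc o 1+o<n))
    where
    o : ℕ
    o = offset (toℕ a) (toℕ b)
    o′≡1+o : offset (toℕ a) (toℕ c) ≡ suc o
    o′≡1+o = offset-suc (toℕ<n a) next (rep-≢ h₁ rep₁) (rep-≢ h₂ rep₂)
    1+o<n : suc o < n
    1+o<n = subst (_< n) o′≡1+o (offset<n (toℕ<n a) (toℕ<n c) (rep-≢ h₂ rep₂))
    d₂≡ : ‖ suc o ‖ ≡ dist x₂ y₂
    d₂≡ = trans (cong ‖_‖ (sym o′≡1+o)) (rep-dist h₂ rep₂)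

  adjacent-levels : ∀ {u v} → Adj u v → NeighbourLevels (lev u) (lev v)
  adjacent-levels (down d) = inj₁ (down-lev d)
  adjacent-levels (up d)   = inj₂ (inj₁ (down-lev d))
  adjacent-levels (tok {x<y = h₁} {x'<y' = h₂} _ _ _ rep₁ rep₂ (inj₁ next)) = token-step h₁ h₂ rep₁ rep₂ next
  adjacent-levels (tok {x<y = h₁} {x'<y' = h₂} _ _ _ rep₁ rep₂ (inj₂ next)) =
    NeighbourLevels-sym (token-step h₂ h₁ rep₂ rep₁ next)

  ground-base : ∀ u → lev u ≡ 0 → Σ (Fin n) λ x → Σ (Fin n) λ y → Σ (x <ᶠ y) λ h → u ≡ base x y h
  ground-base (base x y h) _   = x , y , h , refl
  ground-base (layer k i) lev≡0 = contradiction lev≡0 (<⇒≢ (≤-trans 1≤m (m≤m+n m (toℕ k))) ∘ sym)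

  ground-dist : ∀ {x y} (h : x <ᶠ y) → lev (base x y h) ≡ 0 → dist x y ≡ m
  ground-dist {x} {y} h lev≡0 = trans (cong (_+ dist x y) (sym lev≡0)) (lev-base h)

  ground-arc : ∀ {x y} (h : x <ᶠ y) → lev (base x y h) ≡ 0 → Arc (pos (base x y h)) m (toℕ x) (toℕ y)
  ground-arc {x} {y} h lev≡0 =
    subst (λ d → Arc (pos (base x y h)) d (toℕ x) (toℕ y)) (ground-dist h lev≡0) (base-arc h)

  ground-pos<-even : n ≡ m + m → ∀ u → lev u ≡ 0 → pos u < m
  ground-pos<-even n≡2m u lev≡0 with ground-base u lev≡0
  ... | x , y , h , refl with ground-arc h lev≡0
  ...   | inner x≡a a+m≡y   = +-cancelʳ-< m _ _ (subst₂ _<_ (sym a+m≡y) n≡2m (toℕ<n y))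
  ...   | outer _ _ 2m<n    = contradiction n≡2m (<⇒≢ 2m<n ∘ sym)

  low-ground-arc : ∀ {x y} (h : x <ᶠ y) → lev (base x y h) ≡ 0 → pos (base x y h) < m →
    toℕ x < m × toℕ x + m ≡ toℕ y
  low-ground-arc h lev≡0 a<m with ground-arc h lev≡0
  ... | inner x≡a a+m≡y = subst (_< m) (sym x≡a) a<m , subst (λ a → a + m ≡ _) (sym x≡a) a+m≡y
  ... | outer y≡a a+m≡n+x _ =
    contradiction (+-cancelʳ-≤ m m _ (subst (m + m ≤_) (sym a+m≡n+x) (≤-trans 2m≤n (m≤m+n n _)))) (<⇒≱ a<m)

  Next-irreflexive : ∀ {B} → ¬ Next n B B
  Next-irreflexive (inj₁ 1+B≡B)           = 1+n≢n 1+B≡B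
  Next-irreflexive (inj₂ (1+B≡n , refl)) = <-irrefl refl (subst (1 <_) (sym 1+B≡n) 2≤n)

  CycAdj-irreflexive : ∀ {b} → ¬ CycAdj n b b
  CycAdj-irreflexive (inj₁ next) = Next-irreflexive next
  CycAdj-irreflexive (inj₂ next) = Next-irreflexive next

  -- Two chords {x, x+m} with x < m that share an end are equal, so no token move joins them.
  low-ground-independent : ∀ u v → lev u ≡ 0 → lev v ≡ 0 → pos u < m → pos v < m → ¬ Adj u v
  low-ground-independent u v lev-u≡0 lev-v≡0 pos-u<m pos-v<m adj
    with ground-base u lev-u≡0 | ground-base v lev-v≡0
  ... | x₁ , y₁ , h₁ , refl | x₂ , y₂ , h₂ , refl
    with low-ground-arc h₁ lev-u≡0 pos-u<m | low-ground-arc h₂ lev-v≡0 pos-v<m | adj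
  ... | _ | _ | down ()
  ... | _ | _ | up ()
  ... | x₁<m , x₁+m≡y₁ | x₂<m , x₂+m≡y₂ | tok _ b c′ rep₁ rep₂ b~c′ =
    CycAdj-irreflexive (subst (CycAdj n b) (sym (other-ends-agree rep₁ rep₂)) b~c′)
    where
    other-ends-agree : ∀ {c b c′} → Rep x₁ y₁ c b → Rep x₂ y₂ c c′ → b ≡ c′
    other-ends-agree (inj₁ (refl , refl)) (inj₁ (refl , refl)) = toℕ-injective (trans (sym x₁+m≡y₁) x₂+m≡y₂)
    other-ends-agree (inj₂ (refl , refl)) (inj₂ (refl , refl)) =
      toℕ-injective (+-cancelʳ-≡ m _ _ (trans x₁+m≡y₁ (sym x₂+m≡y₂)))
    other-ends-agree (inj₁ (refl , refl)) (inj₂ (refl , refl)) =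
      contradiction (subst (m ≤_) x₂+m≡y₂ (m≤n+m m (toℕ x₂))) (<⇒≱ x₁<m)
    other-ends-agree (inj₂ (refl , refl)) (inj₁ (refl , refl)) =
      contradiction (subst (m ≤_) x₁+m≡y₁ (m≤n+m m (toℕ x₁))) (<⇒≱ x₂<m)

  -- For odd n this numbers the level-0 chords along their odd cycle: {x, x+m} ↦ 2x and
  -- {x, x+m+1} ↦ 2x+1. The value on layer vertices is junk.
  ground-code : Vtx n p → ℕ
  ground-code (base x y _) = toℕ x + (toℕ y ∸ m)
  ground-code (layer _ _)  = 0

  module OddGround (n≡2m+1 : n ≡ suc (m + m)) where

    data GroundView : Vtx n p → Set where
      chord : ∀ {x y} (h : x <ᶠ y) b → b ≤ 1 → toℕ x + (m + b) ≡ toℕ y → GroundView (base x y h)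

    ground-view : ∀ u → lev u ≡ 0 → GroundView u
    ground-view u lev≡0 with ground-base u lev≡0
    ... | x , y , h , refl with ground-arc h lev≡0
    ...   | inner x≡a a+m≡y =
      chord h 0 z≤n (trans (cong (toℕ x +_) (+-identityʳ m)) (trans (cong (_+ m) x≡a) a+m≡y))
    ...   | outer y≡a a+m≡n+x _ = chord h 1 ≤-refl (+-cancelʳ-≡ m _ _ (begin
      toℕ x + (m + 1) + m      ≡⟨ rearrange (toℕ x) m ⟩
      suc (m + m) + toℕ x      ≡⟨ cong (_+ toℕ x) n≡2m+1 ⟨
      n + toℕ x                ≡⟨ a+m≡n+x ⟨
      pos (base x y h) + m     ≡⟨ cong (_+ m) y≡a ⟨
      toℕ y + m                ∎))
      where
      open ≡-Reasoning
      rearrange : ∀ a b → a + (b + 1) + b ≡ suc (b + b) + a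
      rearrange = solve-∀

    chord-code : ∀ {x y} {h : x <ᶠ y} {b} → toℕ x + (m + b) ≡ toℕ y →
      ground-code (base x y h) ≡ toℕ x + (toℕ x + b)
    chord-code {x} {y} {b = b} x+m+b≡y = cong (toℕ x +_) (begin
      toℕ y ∸ m               ≡⟨ cong (_∸ m) x+m+b≡y ⟨
      toℕ x + (m + b) ∸ m     ≡⟨ cong (_∸ m) (x∙yz≈xz∙y (toℕ x) m b) ⟩
      toℕ x + b + m ∸ m       ≡⟨ m+n∸n≡m (toℕ x + b) m ⟩
      toℕ x + b               ∎)
      where open ≡-Reasoning

    ground-code-≤ : ∀ {u} → GroundView u → ground-code u ≤ m + m
    ground-code-≤ (chord {x} {y} h b _ x+m+b≡y) = begin
      ground-code (base x y h)      ≡⟨ chord-code {h = h} x+m+b≡y ⟩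
      toℕ x + (toℕ x + b)           ≤⟨ +-mono-≤ (m≤m+n (toℕ x) b) ≤-refl ⟩
      (toℕ x + b) + (toℕ x + b)     ≤⟨ +-mono-≤ x+b≤m x+b≤m ⟩
      m + m                         ∎
      where
      open ≤-Reasoning
      x+b≤m : toℕ x + b ≤ m
      x+b≤m = +-cancelʳ-≤ m _ _ (≤-pred (begin-strict
        toℕ x + b + m       ≡⟨ xy∙z≈x∙zy (toℕ x) b m ⟩
        toℕ x + (m + b)     ≡⟨ x+m+b≡y ⟩
        toℕ y               <⟨ toℕ<n y ⟩
        n                   ≡⟨ n≡2m+1 ⟩
        suc (m + m)         ∎))

    ground-code-injective : ∀ {u v} → GroundView u → GroundView v → ground-code u ≡ ground-code v → u ≡ v
    ground-code-injective (chord {x₁} {y₁} h₁ b₁ b₁≤1 e₁) (chord {x₂} {y₂} h₂ b₂ b₂≤1 e₂) code≡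
      with double-plus-bit-injective (toℕ x₁) (toℕ x₂) b₁≤1 b₂≤1
             (trans (sym (chord-code {h = h₁} e₁)) (trans code≡ (chord-code {h = h₂} e₂)))
    ... | x₁≡x₂ , refl = base-≡ h₁ h₂ x₁≡x₂ (trans (sym e₁) (trans (cong (_+ (m + b₁)) x₁≡x₂) e₂))

    shift : ∀ a c → suc (a + (c + 0)) ≡ a + (c + 1)
    shift = solve-∀

    shift-suc : ∀ a c → suc (a + (c + 1)) ≡ suc a + (suc c + 0)
    shift-suc = solve-∀

    ground-code-suc-adjacent : ∀ {u v} → GroundView u → GroundView v →
      ground-code v ≡ suc (ground-code u) → Adj u v
    ground-code-suc-adjacent (chord {x₁} {y₁} h₁ 0 _ e₁) (chord {x₂} {y₂} h₂ b₂ b₂≤1 e₂) code≡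
      with double-plus-bit-injective (toℕ x₂) (toℕ x₁) b₂≤1 ≤-refl (begin
        toℕ x₂ + (toℕ x₂ + b₂)          ≡⟨ chord-code {h = h₂} e₂ ⟨
        ground-code (base x₂ y₂ h₂)     ≡⟨ code≡ ⟩
        suc (ground-code (base x₁ y₁ h₁)) ≡⟨ cong suc (chord-code {h = h₁} e₁) ⟩
        suc (toℕ x₁ + (toℕ x₁ + 0))     ≡⟨ shift (toℕ x₁) (toℕ x₁) ⟩
        toℕ x₁ + (toℕ x₁ + 1)           ∎)
      where open ≡-Reasoning
    ... | x₂≡x₁ , refl = tok x₁ y₁ y₂ (inj₁ (refl , refl)) (inj₁ (toℕ-injective x₂≡x₁ , refl))
      (inj₁ (inj₁ (begin
        suc (toℕ y₁)                ≡⟨ cong suc e₁ ⟨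
        suc (toℕ x₁ + (m + 0))      ≡⟨ shift (toℕ x₁) m ⟩
        toℕ x₁ + (m + 1)            ≡⟨ cong (_+ (m + 1)) x₂≡x₁ ⟨
        toℕ x₂ + (m + 1)            ≡⟨ e₂ ⟩
        toℕ y₂                      ∎)))
      where open ≡-Reasoning
    ground-code-suc-adjacent (chord {x₁} {y₁} h₁ 1 _ e₁) (chord {x₂} {y₂} h₂ b₂ b₂≤1 e₂) code≡
      with double-plus-bit-injective (toℕ x₂) (suc (toℕ x₁)) b₂≤1 z≤n (begin
        toℕ x₂ + (toℕ x₂ + b₂)          ≡⟨ chord-code {h = h₂} e₂ ⟨
        ground-code (base x₂ y₂ h₂)     ≡⟨ code≡ ⟩
        suc (ground-code (base x₁ y₁ h₁)) ≡⟨ cong suc (chord-code {h = h₁} e₁) ⟩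
        suc (toℕ x₁ + (toℕ x₁ + 1))     ≡⟨ shift-suc (toℕ x₁) (toℕ x₁) ⟩
        suc (toℕ x₁) + (suc (toℕ x₁) + 0) ∎)
      where open ≡-Reasoning
    ... | x₂≡1+x₁ , refl = tok y₁ x₁ x₂ (inj₂ (refl , refl)) (inj₂ (refl , toℕ-injective (begin
        toℕ y₂                      ≡⟨ e₂ ⟨
        toℕ x₂ + (m + 0)            ≡⟨ cong (_+ (m + 0)) x₂≡1+x₁ ⟩
        suc (toℕ x₁) + (m + 0)      ≡⟨ shift (toℕ x₁) m ⟩
        toℕ x₁ + (m + 1)            ≡⟨ e₁ ⟩
        toℕ y₁                      ∎)))
      (inj₁ (inj₁ (sym x₂≡1+x₁)))
      where open ≡-Reasoning
    ground-code-suc-adjacent (chord _ (suc (suc _)) (s≤s ()) _) _ _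

    ground-code-wrap-adjacent : ∀ {u v} → GroundView u → GroundView v →
      ground-code u ≡ 0 → ground-code v ≡ m + m → Adj u v
    ground-code-wrap-adjacent (chord {x₁} {y₁} h₁ b₁ b₁≤1 e₁) (chord {x₂} {y₂} h₂ b₂ b₂≤1 e₂) code₁≡0 code₂≡2m
      with double-plus-bit-injective (toℕ x₁) 0 b₁≤1 z≤n (trans (sym (chord-code {h = h₁} e₁)) code₁≡0)
         | double-plus-bit-injective (toℕ x₂) m b₂≤1 z≤n
             (trans (sym (chord-code {h = h₂} e₂)) (trans code₂≡2m (cong (m +_) (sym (+-identityʳ m)))))
    ... | x₁≡0 , refl | x₂≡m , refl =
      tok y₁ x₁ y₂ (inj₂ (refl , refl)) (inj₁ (toℕ-injective (trans x₂≡m (sym y₁≡m)) , refl))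
        (inj₂ (inj₂ (1+y₂≡n , x₁≡0)))
      where
      open ≡-Reasoning
      y₁≡m : toℕ y₁ ≡ m
      y₁≡m = begin
        toℕ y₁             ≡⟨ e₁ ⟨
        toℕ x₁ + (m + 0)   ≡⟨ cong₂ _+_ x₁≡0 (+-identityʳ m) ⟩
        m                  ∎
      1+y₂≡n : suc (toℕ y₂) ≡ n
      1+y₂≡n = begin
        suc (toℕ y₂)             ≡⟨ cong suc e₂ ⟨
        suc (toℕ x₂ + (m + 0))   ≡⟨ cong suc (cong₂ _+_ x₂≡m (+-identityʳ m)) ⟩
        suc (m + m)              ≡⟨ n≡2m+1 ⟨
        n                        ∎

  chord-at : (a : Fin n) (d : ℕ) → 1 ≤ d → d ≤ m → d < m ⊎ toℕ a + d < n →
    Σ (Vtx n p) λ u → lev u ≡ m ∸ d × pos u ≡ toℕ a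
  chord-at a d 1≤d d≤m short-or-inner with toℕ a + d <? n
  ... | yes a+d<n = base a y a<y , cong (m ∸_) (proj₂ coords) , proj₁ coords
    where
    y : Fin n
    y = fromℕ< a+d<n
    y≡a+d : toℕ y ≡ toℕ a + d
    y≡a+d = toℕ-fromℕ< a+d<n
    a<y : a <ᶠ y
    a<y = subst (toℕ a <_) (sym y≡a+d) (m<m+n (toℕ a) 1≤d)
    coords : anchor (toℕ a) (toℕ y) ≡ toℕ a × ‖ toℕ y ∸ toℕ a ‖ ≡ d
    coords = subst (λ Y → anchor (toℕ a) Y ≡ toℕ a × ‖ Y ∸ toℕ a ‖ ≡ d) (sym y≡a+d)
               (inner-chord-coords (≤-trans (+-mono-≤ d≤m d≤m) 2m≤n))
  ... | no a+d≮n = base x a x<a , cong (m ∸_) (proj₂ coords) , proj₁ coords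
    where
    d<m : d < m
    d<m = fromInj₁ (λ a+d<n → contradiction a+d<n a+d≮n) short-or-inner
    X : ℕ
    X = toℕ a + d ∸ n
    X+n≡a+d : X + n ≡ toℕ a + d
    X+n≡a+d = m∸n+n≡m (≮⇒≥ a+d≮n)
    X<a : X < toℕ a
    X<a = +-cancelʳ-< n X (toℕ a) (subst (_< toℕ a + n) (sym X+n≡a+d) (+-monoʳ-< (toℕ a) (<-≤-trans d<m m≤n)))
    x : Fin n
    x = fromℕ< (<-trans X<a (toℕ<n a))
    x≡X : toℕ x ≡ X
    x≡X = toℕ-fromℕ< (<-trans X<a (toℕ<n a))
    x<a : x <ᶠ a
    x<a = subst (_< toℕ a) (sym x≡X) X<a
    coords : anchor (toℕ x) (toℕ a) ≡ toℕ a × ‖ toℕ a ∸ toℕ x ‖ ≡ d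
    coords = subst (λ X → anchor X (toℕ a) ≡ toℕ a × ‖ toℕ a ∸ X ‖ ≡ d) (sym x≡X)
               (outer-chord-coords X<a (trans (sym X+n≡a+d) (+-comm X n)) (<-≤-trans (+-mono-< d<m d<m) 2m≤n))

  -- For even n, level 0 only has the positions below m.
  vertex-at : ∀ l (a : Fin n) → l < m + p → 1 ≤ l ⊎ toℕ a < m → Σ (Vtx n p) λ u → lev u ≡ l × pos u ≡ toℕ a
  vertex-at l a l<m+p above-or-low with l <? m
  ... | yes l<m with chord-at a (m ∸ l) (m<n⇒0<n∸m l<m) (m∸n≤m m l) (short-or-inner above-or-low)
    where
    short-or-inner : 1 ≤ l ⊎ toℕ a < m → m ∸ l < m ⊎ toℕ a + (m ∸ l) < n
    short-or-inner (inj₁ 1≤l) = inj₁ (∸-monoʳ-< 1≤l (<⇒≤ l<m))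
    short-or-inner (inj₂ a<m) = inj₂ (<-≤-trans (+-mono-<-≤ a<m (m∸n≤m m l)) 2m≤n)
  ...   | u , lev≡m∸[m∸l] , pos≡a = u , trans lev≡m∸[m∸l] (m∸[m∸n]≡n (<⇒≤ l<m)) , pos≡a
  vertex-at l a l<m+p _ | no l≮m = layer (fromℕ< l∸m<p) a , trans (cong (m +_) (toℕ-fromℕ< l∸m<p)) m+[l∸m]≡l , refl
    where
    m+[l∸m]≡l : m + (l ∸ m) ≡ l
    m+[l∸m]≡l = m+[n∸m]≡n (≮⇒≥ l≮m)
    l∸m<p : l ∸ m < p
    l∸m<p = +-cancelˡ-< m _ _ (subst (_< m + p) (sym m+[l∸m]≡l) l<m+p)

module IndependenceBounds (n p m : ℕ) (2m≤n : m + m ≤ n) (n≤2m+1 : n ≤ suc (m + m)) (1≤m : 1 ≤ m) where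
  open Chords n m 2m≤n n≤2m+1 1≤m
  open Coordinates n p m 2m≤n n≤2m+1 1≤m

  stacked-collision : ∀ {u v} → ¬ Adj u v → ¬ Adj v u → pos u ≡ pos v → lev u ≈₁ lev v → u ≡ v
  stacked-collision {u} {v} _ _ pos≡ (inj₁ lev≡) = coords-injective u v lev≡ pos≡
  stacked-collision {u} {v} ¬uv _ pos≡ (inj₂ (inj₁ lev≡)) = contradiction (stacked-adjacent u v lev≡ pos≡) ¬uv
  stacked-collision {u} {v} _ ¬vu pos≡ (inj₂ (inj₂ lev≡)) = contradiction (stacked-adjacent v u lev≡ (sym pos≡)) ¬vu

  upper-bound-even : ∀ q → m + p ≡ q + q → ∀ S → Independent S → length S ≤ q * n
  upper-bound-even q m+p≡2q S (unique , indep) =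
    rank-position⇒length≤ q n lev pos unique (λ {u} _ → subst (lev u <_) m+p≡2q (lev< u)) (λ {u} _ → pos< u)
      (λ u∈ v∈ → stacked-collision (indep u∈ v∈) (indep v∈ u∈))

  ground-bound : ∀ {T} → Unique T → (∀ {u v} → u ∈ T → v ∈ T → ¬ Adj u v) → (∀ {u} → u ∈ T → lev u ≡ 0) →
    length T ≤ m
  ground-bound {T} unique indep ground with m≤n⇒m<n∨m≡n n≤2m+1
  ... | inj₂ n≡2m+1 = odd-cycle⇒length≤ m Adj ground-code unique indep
    (λ u∈ → ground-code-≤ (view u∈))
    (λ u∈ v∈ → ground-code-injective (view u∈) (view v∈))
    (λ u∈ v∈ → ground-code-suc-adjacent (view u∈) (view v∈))
    (λ u∈ v∈ → ground-code-wrap-adjacent (view u∈) (view v∈))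
    where
    open OddGround n≡2m+1
    view : ∀ {u} → u ∈ T → GroundView u
    view {u} u∈ = ground-view u (ground u∈)
  ... | inj₁ n<2m+1 = injective-code⇒length≤ unique (λ {u} u∈ → fromℕ< (ground-pos<-even n≡2m u (ground u∈)))
    (λ {u} {v} u∈ v∈ eq → coords-injective u v (trans (ground u∈) (sym (ground v∈))) (fromℕ<-injective _ _ _ _ eq))
    where
    n≡2m : n ≡ m + m
    n≡2m = ≤-antisym (≤-pred n<2m+1) 2m≤n

  upper-bound-odd : ∀ q → m + p ≡ suc (q + q) → ∀ S → Independent S → length S ≤ q * n + m
  upper-bound-odd q m+p≡1+2q S (unique , indep) = begin
    length S                  ≡⟨ length-filter+∁ ground? S ⟩
    length S₀ + length S₊     ≤⟨ +-mono-≤ S₀-bound S₊-bound ⟩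
    m + q * n                 ≡⟨ +-comm m (q * n) ⟩
    q * n + m                 ∎
    where
    open ≤-Reasoning
    ground? : Decidable (λ u → lev u ≡ 0)
    ground? u = lev u ≟ 0
    S₀ S₊ : List (Vtx n p)
    S₀ = filter ground? S
    S₊ = filter (∁? ground?) S
    from-S₀ : ∀ {u} → u ∈ S₀ → u ∈ S × lev u ≡ 0
    from-S₀ = ∈-filter⁻ ground? {xs = S}
    from-S₊ : ∀ {u} → u ∈ S₊ → u ∈ S × lev u ≢ 0
    from-S₊ = ∈-filter⁻ (∁? ground?) {xs = S}
    S₀-bound : length S₀ ≤ m
    S₀-bound = ground-bound (filter⁺ ground? unique)
      (λ u∈ v∈ → indep (proj₁ (from-S₀ u∈)) (proj₁ (from-S₀ v∈))) (proj₂ ∘ from-S₀)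
    S₊-bound : length S₊ ≤ q * n
    S₊-bound = rank-position⇒length≤ q n (pred ∘ lev) pos (filter⁺ (∁? ground?) unique)
      (λ {u} u∈ → a<1+K⇒pred[a]<K (proj₂ (from-S₊ u∈)) (subst (lev u <_) m+p≡1+2q (lev< u))) (λ {u} _ → pos< u)
      (λ u∈ v∈ pos≡ → stacked-collision (indep (proj₁ (from-S₊ u∈)) (proj₁ (from-S₊ v∈)))
                         (indep (proj₁ (from-S₊ v∈)) (proj₁ (from-S₊ u∈))) pos≡
                       ∘ pred-reflects-≈₁ (proj₂ (from-S₊ u∈)) (proj₂ (from-S₊ v∈)))

  module Rows (b q : ℕ) (b+2q≡m+p : b + (q + q) ≡ m + p) where

    level : Fin q → ℕ
    level j = suc (b + (toℕ j + toℕ j))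

    level<m+p : ∀ j → level j < m + p
    level<m+p j = begin
      suc (suc (b + (toℕ j + toℕ j)))   ≡⟨ cong suc (+-suc b _) ⟨
      suc (b + suc (toℕ j + toℕ j))     ≡⟨ +-suc b _ ⟨
      b + suc (suc (toℕ j + toℕ j))     ≡⟨ cong (λ k → b + suc k) (+-suc (toℕ j) (toℕ j)) ⟨
      b + (suc (toℕ j) + suc (toℕ j))   ≤⟨ +-monoʳ-≤ b (+-mono-≤ (toℕ<n j) (toℕ<n j)) ⟩
      b + (q + q)                       ≡⟨ b+2q≡m+p ⟩
      m + p                             ∎
      where open ≤-Reasoning

    level-apart : ∀ j j′ → ¬ NeighbourLevels (level j) (level j′)
    level-apart j j′ (inj₁ eq) = double≢suc-double (toℕ j) (toℕ j′)
      (+-cancelˡ-≡ b _ _ (trans (suc-injective eq) (sym (+-suc b _))))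
    level-apart j j′ (inj₂ (inj₁ eq)) = double≢suc-double (toℕ j′) (toℕ j)
      (+-cancelˡ-≡ b _ _ (trans (suc-injective eq) (sym (+-suc b _))))
    level-apart j j′ (inj₂ (inj₂ (() , _)))

    cell : Fin q × Fin n → Vtx n p
    cell (j , i) = proj₁ (vertex-at (level j) i (level<m+p j) (inj₁ (s≤s z≤n)))

    cell-coords : ∀ c → lev (cell c) ≡ level (proj₁ c) × pos (cell c) ≡ toℕ (proj₂ c)
    cell-coords (j , i) = proj₂ (vertex-at (level j) i (level<m+p j) (inj₁ (s≤s z≤n)))

    cell-injective : ∀ {c c′} → cell c ≡ cell c′ → c ≡ c′
    cell-injective {j , i} {j′ , i′} eq = cong₂ _,_ (toℕ-injective j≡j′) (toℕ-injective i≡i′)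
      where
      open ≡-Reasoning
      lev≡ : level j ≡ level j′
      lev≡ = trans (sym (proj₁ (cell-coords (j , i)))) (trans (cong lev eq) (proj₁ (cell-coords (j′ , i′))))
      i≡i′ : toℕ i ≡ toℕ i′
      i≡i′ = trans (sym (proj₂ (cell-coords (j , i)))) (trans (cong pos eq) (proj₂ (cell-coords (j′ , i′))))
      j≡j′ : toℕ j ≡ toℕ j′
      j≡j′ = begin
        toℕ j                       ≡⟨ n≡⌊n+n/2⌋ (toℕ j) ⟩
        ⌊ toℕ j + toℕ j /2⌋         ≡⟨ cong ⌊_/2⌋ (+-cancelˡ-≡ b _ _ (suc-injective lev≡)) ⟩
        ⌊ toℕ j′ + toℕ j′ /2⌋       ≡⟨ n≡⌊n+n/2⌋ (toℕ j′) ⟨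
        toℕ j′                      ∎

    rows : List (Vtx n p)
    rows = tabulate (cell ∘ remQuot {q} n)

    rows-length : length rows ≡ q * n
    rows-length = length-tabulate (cell ∘ remQuot {q} n)

    rows-unique : Unique rows
    rows-unique = tabulate⁺ λ {k} {k′} eq →
      remQuot-injective {q} n (cell-injective {remQuot {q} n k} {remQuot {q} n k′} eq)

    rows-level : ∀ {u} → u ∈ rows → Σ (Fin q) λ j → lev u ≡ level j
    rows-level u∈ with ∈-tabulate⁻ u∈
    ... | k , refl = proj₁ (remQuot {q} n k) , proj₁ (cell-coords (remQuot {q} n k))

    rows-independent : ∀ {u v} → u ∈ rows → v ∈ rows → ¬ Adj u v
    rows-independent u∈ v∈ adj with rows-level u∈ | rows-level v∈
    ... | j , lev-u≡ | j′ , lev-v≡ = level-apart j j′ (subst₂ NeighbourLevels lev-u≡ lev-v≡ (adjacent-levels adj))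

  lower-bound-even : ∀ q → m + p ≡ q + q → Σ (List (Vtx n p)) λ S → Independent S × length S ≡ q * n
  lower-bound-even q m+p≡2q = rows , (rows-unique , rows-independent) , rows-length
    where open Rows 0 q (sym m+p≡2q)

  ground-vertex : (a : Fin m) → Σ (Vtx n p) λ u → lev u ≡ 0 × pos u ≡ toℕ a
  ground-vertex a with vertex-at 0 (inject≤ a m≤n) (≤-trans 1≤m (m≤m+n m p))
                         (inj₂ (subst (_< m) (sym (toℕ-inject≤ a m≤n)) (toℕ<n a)))
  ... | u , lev≡0 , pos≡ = u , lev≡0 , trans pos≡ (toℕ-inject≤ a m≤n)

  ground-row : List (Vtx n p)
  ground-row = tabulate (proj₁ ∘ ground-vertex)

  ground-row-low : ∀ {u} → u ∈ ground-row → lev u ≡ 0 × pos u < m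
  ground-row-low u∈ with ∈-tabulate⁻ u∈
  ... | a , refl = proj₁ (proj₂ (ground-vertex a)) , subst (_< m) (sym (proj₂ (proj₂ (ground-vertex a)))) (toℕ<n a)

  ground-row-unique : Unique ground-row
  ground-row-unique = tabulate⁺ λ {a} {a′} eq → toℕ-injective (begin
    toℕ a                         ≡⟨ proj₂ (proj₂ (ground-vertex a)) ⟨
    pos (proj₁ (ground-vertex a))  ≡⟨ cong pos eq ⟩
    pos (proj₁ (ground-vertex a′)) ≡⟨ proj₂ (proj₂ (ground-vertex a′)) ⟩
    toℕ a′                        ∎)
    where open ≡-Reasoning

  ground-row-independent : ∀ {u v} → u ∈ ground-row → v ∈ ground-row → ¬ Adj u v
  ground-row-independent {u} {v} u∈ v∈ with ground-row-low u∈ | ground-row-low v∈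
  ... | lev-u≡0 , pos-u<m | lev-v≡0 , pos-v<m = low-ground-independent u v lev-u≡0 lev-v≡0 pos-u<m pos-v<m

  ground-apart : ∀ x → ¬ NeighbourLevels 0 (suc (suc x))
  ground-apart x (inj₁ ())
  ground-apart x (inj₂ (inj₁ ()))
  ground-apart x (inj₂ (inj₂ (_ , ())))

  lower-bound-odd : ∀ q → m + p ≡ suc (q + q) → Σ (List (Vtx n p)) λ S → Independent S × length S ≡ q * n + m
  lower-bound-odd q m+p≡1+2q = ground-row ++ rows , (++⁺ ground-row-unique rows-unique disjoint , indep) , (begin
    length (ground-row ++ rows)        ≡⟨ length-++ ground-row ⟩
    length ground-row + length rows    ≡⟨ cong₂ _+_ (length-tabulate (proj₁ ∘ ground-vertex)) rows-length ⟩
    m + q * n                          ≡⟨ +-comm m (q * n) ⟩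
    q * n + m                          ∎)
    where
    open Rows 1 q (sym m+p≡1+2q)
    open ≡-Reasoning
    ground-rows-apart : ∀ {u v} → u ∈ ground-row → v ∈ rows → ¬ NeighbourLevels (lev u) (lev v)
    ground-rows-apart u∈ v∈ with ground-row-low u∈ | rows-level v∈
    ... | lev-u≡0 , _ | j , lev-v≡ =
      subst₂ (λ a b → ¬ NeighbourLevels a b) (sym lev-u≡0) (sym lev-v≡) (ground-apart _)
    disjoint : ∀ {v} → ¬ (v ∈ ground-row × v ∈ rows)
    disjoint (v∈g , v∈r) with rows-level v∈r
    ... | _ , lev≡ = 0≢1+n (trans (sym (proj₁ (ground-row-low v∈g))) lev≡)
    indep : ∀ {u v} → u ∈ ground-row ++ rows → v ∈ ground-row ++ rows → ¬ Adj u v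
    indep u∈ v∈ adj with ∈-++⁻ ground-row u∈ | ∈-++⁻ ground-row v∈
    ... | inj₁ u∈g | inj₁ v∈g = ground-row-independent u∈g v∈g adj
    ... | inj₁ u∈g | inj₂ v∈r = ground-rows-apart u∈g v∈r (adjacent-levels adj)
    ... | inj₂ u∈r | inj₁ v∈g = ground-rows-apart v∈g u∈r (NeighbourLevels-sym (adjacent-levels adj))
    ... | inj₂ u∈r | inj₂ v∈r = rows-independent u∈r v∈r adj

  independence-number-even : (m + p) % 2 ≡ 0 → IsIndependenceNumber n p ((m + p) / 2 * n)
  independence-number-even even = lower-bound-even q m+p≡2q , upper-bound-even q m+p≡2q
    where
    q : ℕ
    q = (m + p) / 2
    m+p≡2q : m + p ≡ q + q
    m+p≡2q = %2≡0⇒double (m + p) even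

  independence-number-odd : (m + p) % 2 ≡ 1 → IsIndependenceNumber n p ((m + p) / 2 * n + m)
  independence-number-odd odd = lower-bound-odd q m+p≡1+2q , upper-bound-odd q m+p≡1+2q
    where
    q : ℕ
    q = (m + p) / 2
    m+p≡1+2q : m + p ≡ suc (q + q)
    m+p≡1+2q = %2≡1⇒suc-double (m + p) odd

double-* : ∀ q n → 2 * (q * n) ≡ (q + q) * n
double-* = solve-∀

%2-of-sum : ∀ m p {a b} → m % 2 ≡ a → p % 2 ≡ b → (m + p) % 2 ≡ (a + b) % 2
%2-of-sum m p m%2≡a p%2≡b = trans (%-distribˡ-+ m p 2) (cong₂ (λ a b → (a + b) % 2) m%2≡a p%2≡b)

2r%2≡0 : ∀ r → (2 * r) % 2 ≡ 0
2r%2≡0 r = trans (cong (_% 2) (*-comm 2 r)) (m*n%n≡0 r 2)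

2r+1%2≡1 : ∀ r → (2 * r + 1) % 2 ≡ 1
2r+1%2≡1 r = trans (cong (_% 2) (trans (+-comm (2 * r) 1) (cong suc (*-comm 2 r)))) ([m+kn]%n≡m%n 1 r 2)

independence-number-2m : ∀ {n p m} → n ≡ m + m → 1 ≤ m →
  Σ ℕ λ k → IsIndependenceNumber n p k × 2 * k ≡ (m + p) * n
independence-number-2m {n} {p} {m} refl 1≤m with %2-cases (m + p)
... | inj₁ even = _ , independence-number-even even ,
  trans (double-* ((m + p) / 2) n) (cong (_* n) (sym (%2≡0⇒double (m + p) even)))
  where open IndependenceBounds n p m ≤-refl (n≤1+n n) 1≤m
... | inj₂ odd = _ , independence-number-odd odd ,
  trans (doubled ((m + p) / 2) m) (cong (_* n) (sym (%2≡1⇒suc-double (m + p) odd)))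
  where
  open IndependenceBounds n p m ≤-refl (n≤1+n n) 1≤m
  doubled : ∀ q m → 2 * (q * (m + m) + m) ≡ suc (q + q) * (m + m)
  doubled = solve-∀

independence-number-2m+1 : ∀ {n p m} → n ≡ suc (m + m) → 1 ≤ m →
  ((m + p) % 2 ≡ 0 → Σ ℕ λ k → IsIndependenceNumber n p k × 2 * k ≡ (m + p) * n) ×
  ((m + p) % 2 ≡ 1 → Σ ℕ λ k → IsIndependenceNumber n p k × 2 * k + 1 ≡ (m + p) * n)
independence-number-2m+1 {n} {p} {m} refl 1≤m =
  (λ even → _ , independence-number-even even ,
     trans (double-* ((m + p) / 2) n) (cong (_* n) (sym (%2≡0⇒double (m + p) even)))) ,
  (λ odd → _ , independence-number-odd odd ,
     trans (doubled ((m + p) / 2) m) (cong (_* n) (sym (%2≡1⇒suc-double (m + p) odd))))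
  where
  open IndependenceBounds n p m (n≤1+n (m + m)) ≤-refl 1≤m
  doubled : ∀ q m → 2 * (q * suc (m + m) + m) + 1 ≡ suc (q + q) * suc (m + m)
  doubled = solve-∀

1≤2r : ∀ {n} r → 2 ≤ n → n ≤ 4 * r + 1 → 1 ≤ 2 * r
1≤2r zero    2≤n n≤1 = contradiction (≤-trans 2≤n n≤1) λ { (s≤s ()) }
1≤2r (suc r) _   _   = s≤s z≤n

mainTheorem11 : (n p r : ℕ) → 2 ≤ n →
    ((n ≡ 4 * r) →
       Σ ℕ λ k → IsIndependenceNumber n p k × (2 * k ≡ (2 * r + p) * n)) ×
    ((n ≡ 4 * r + 1) → p % 2 ≡ 0 →
       Σ ℕ λ k → IsIndependenceNumber n p k × (2 * k ≡ (2 * r + p) * n)) ×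
    ((n ≡ 4 * r + 1) → p % 2 ≡ 1 →
       Σ ℕ λ k → IsIndependenceNumber n p k × (2 * k + 1 ≡ (2 * r + p) * n)) ×
    ((n ≡ 4 * r + 2) →
       Σ ℕ λ k → IsIndependenceNumber n p k × (2 * k ≡ (2 * r + p + 1) * n)) ×
    ((n ≡ 4 * r + 3) → p % 2 ≡ 0 →
       Σ ℕ λ k → IsIndependenceNumber n p k × (2 * k + 1 ≡ (2 * r + p + 1) * n)) ×
    ((n ≡ 4 * r + 3) → p % 2 ≡ 1 →
       Σ ℕ λ k → IsIndependenceNumber n p k × (2 * k ≡ (2 * r + p + 1) * n))
mainTheorem11 n p r 2≤n =
    (λ n≡4r → independence-number-2m (trans n≡4r 4r≡2r+2r)
                (1≤2r r 2≤n (≤-trans (≤-reflexive n≡4r) (m≤m+n _ 1))))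
  , (λ n≡4r+1 p-even →
       proj₁ (independence-number-2m+1 (trans n≡4r+1 4r+1≡1+2r+2r) (1≤2r r 2≤n (≤-reflexive n≡4r+1)))
             (%2-of-sum (2 * r) p (2r%2≡0 r) p-even))
  , (λ n≡4r+1 p-odd →
       proj₂ (independence-number-2m+1 (trans n≡4r+1 4r+1≡1+2r+2r) (1≤2r r 2≤n (≤-reflexive n≡4r+1)))
             (%2-of-sum (2 * r) p (2r%2≡0 r) p-odd))
  , (λ n≡4r+2 → reorder (independence-number-2m (trans n≡4r+2 (4r+2≡[2r+1]+[2r+1] r)) 1≤2r+1))
  , (λ n≡4r+3 p-even → reorder
       (proj₂ (independence-number-2m+1 (trans n≡4r+3 (4r+3≡1+[2r+1]+[2r+1] r)) 1≤2r+1)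
              (%2-of-sum (2 * r + 1) p (2r+1%2≡1 r) p-even)))
  , (λ n≡4r+3 p-odd → reorder
       (proj₁ (independence-number-2m+1 (trans n≡4r+3 (4r+3≡1+[2r+1]+[2r+1] r)) 1≤2r+1)
              (%2-of-sum (2 * r + 1) p (2r+1%2≡1 r) p-odd)))
  where
  1≤2r+1 : 1 ≤ 2 * r + 1
  1≤2r+1 = m≤n+m 1 (2 * r)
  4r≡2r+2r : 4 * r ≡ 2 * r + 2 * r
  4r≡2r+2r = *-distribʳ-+ r 2 2
  4r+1≡1+2r+2r : 4 * r + 1 ≡ suc (2 * r + 2 * r)
  4r+1≡1+2r+2r = trans (+-comm (4 * r) 1) (cong suc 4r≡2r+2r)
  4r+2≡[2r+1]+[2r+1] : ∀ r → 4 * r + 2 ≡ (2 * r + 1) + (2 * r + 1)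
  4r+2≡[2r+1]+[2r+1] = solve-∀
  4r+3≡1+[2r+1]+[2r+1] : ∀ r → 4 * r + 3 ≡ suc ((2 * r + 1) + (2 * r + 1))
  4r+3≡1+[2r+1]+[2r+1] = solve-∀
  reorder : ∀ {f : ℕ → ℕ} → (Σ ℕ λ k → IsIndependenceNumber n p k × f k ≡ (2 * r + 1 + p) * n) →
    Σ ℕ λ k → IsIndependenceNumber n p k × f k ≡ (2 * r + p + 1) * n
  reorder (k , α , eq) = k , α , trans eq (cong (_* n) (xy∙z≈xz∙y (2 * r) 1 p))
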